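{- Let $G_1,G_2,H_1,H_2,K_1,K_2,L$ be graphs (with pairwise disjoint vertex sets where unions/joins are formed) and let $h:(G_1\wedge G_2)\vee(H_1\vee H_2)\to(K_1\wedge K_2)\vee L$ be a skew fibration with $h(V(G_i))\subseteq V(K_i)$ and $h(V(H_i))\subseteq V(L)$ for $i=1,2$. Then for $i=1,2$ the map $h_i:G_i\vee H_i\to K_i\vee L$ defined by $h_i(v)=h(v)$ is a skew fibration.
   Context: A graph $(V,E)$: finite $V$, $E$ a set of two-element subsets of $V$; write $vw$. A homomorphism $h:G\to G'$ satisfies $vw\in E(G)\Rightarrow h(v)h(w)\in E(G')$. For disjoint vertex sets, union $G\vee G'=(V\cup V',E\cup E')$; join $G\wedge G'$ additionally contains all edges $vv'$ with $v\in V$, $v'\in V'$. A homomorphism $h:G\to G'$ is a skew fibration if for every $v\in V(G)$ and every $w$ with $h(v)w\in E(G')$ there is $\hat w$ with $v\hat w\in E(G)$ and $h(\hat w)w\notin E(G')$. -}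

module Defs where

open import Level using (0ℓ)
open import Data.Nat using (ℕ; _+_)
open import Data.Fin using (Fin)
open import Data.Fin.Properties using (+↔⊎)
open import Data.Sum using (_⊎_; inj₁; inj₂)
open import Data.Product using (Σ; ∃; _,_; proj₁; _×_)
open import Data.Empty using (⊥)
open import Data.Unit using (⊤)
open import Relation.Nullary using (¬_)
open import Relation.Binary.PropositionalEquality using (_≡_)
open import Function.Bundles using (_↔_)
open import Function.Construct.Composition using (_↔-∘_)
open import Data.Sum.Function.Propositional using (_⊎-↔_)

record Graph : Set₁ where
  field
    V     : Set
    size  : ℕ
    fin   : Fin size ↔ V
    Adj   : V → V → Set
    sym   : ∀ {v w} → Adj v w → Adj w v
    irr   : ∀ {v} → ¬ Adj v v
open Graph public

_∨_ : Graph → Graph → Graph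
G ∨ G' = record
  { V = V G ⊎ V G'
  ; size = size G + size G'
  ; fin = (fin G ⊎-↔ fin G') ↔-∘ +↔⊎
  ; Adj = A
  ; sym = λ {v} {w} → s {v} {w}
  ; irr = λ {v} → i {v}
  }
  where
  A : V G ⊎ V G' → V G ⊎ V G' → Set
  A (inj₁ v) (inj₁ w) = Adj G v w
  A (inj₂ v) (inj₂ w) = Adj G' v w
  A (inj₁ _) (inj₂ _) = ⊥
  A (inj₂ _) (inj₁ _) = ⊥
  s : ∀ {v w} → A v w → A w v
  s {inj₁ _} {inj₁ _} e = sym G e
  s {inj₂ _} {inj₂ _} e = sym G' e
  i : ∀ {v} → ¬ A v v
  i {inj₁ _} = irr G
  i {inj₂ _} = irr G'

_∧_ : Graph → Graph → Graph
G ∧ G' = record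
  { V = V G ⊎ V G'
  ; size = size G + size G'
  ; fin = (fin G ⊎-↔ fin G') ↔-∘ +↔⊎
  ; Adj = A
  ; sym = λ {v} {w} → s {v} {w}
  ; irr = λ {v} → i {v}
  }
  where
  A : V G ⊎ V G' → V G ⊎ V G' → Set
  A (inj₁ v) (inj₁ w) = Adj G v w
  A (inj₂ v) (inj₂ w) = Adj G' v w
  A (inj₁ _) (inj₂ _) = ⊤
  A (inj₂ _) (inj₁ _) = ⊤
  s : ∀ {v w} → A v w → A w v
  s {inj₁ _} {inj₁ _} e = sym G e
  s {inj₂ _} {inj₂ _} e = sym G' e
  s {inj₁ _} {inj₂ _} e = e
  s {inj₂ _} {inj₁ _} e = e
  i : ∀ {v} → ¬ A v v
  i {inj₁ _} = irr G
  i {inj₂ _} = irr G'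

infixr 6 _∧_
infixr 5 _∨_

IsHomomorphism : (G G' : Graph) → (V G → V G') → Set
IsHomomorphism G G' h = ∀ v w → Adj G v w → Adj G' (h v) (h w)

IsSkewFibration : (G G' : Graph) → (V G → V G') → Set
IsSkewFibration G G' h =
  IsHomomorphism G G' h ×
  (∀ v w → Adj G' (h v) w → Σ (V G) λ ŵ → Adj G v ŵ × ¬ Adj G' (h ŵ) w)

-- Adjacency confines ŵ to the same side of the union as v;
-- on the join side, ŵ cannot lie in the other G_j, since h sends it into K_j and
-- every vertex of K_j is adjacent to w ∈ K_i.  So the witness can be reused for h_i.
module Submission where

open import Defs
open import Function using (id)
open import Data.Sum using (inj₁; inj₂) renaming (map to ⊎-map)
open import Data.Product using (Σ; proj₁; proj₂; _×_; _,_)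
open import Data.Unit using (tt)
open import Data.Empty using (⊥-elim)
open import Relation.Nullary using (¬_)
open import Relation.Binary.PropositionalEquality using (_≡_; refl; subst; subst₂) renaming (sym to ≡-sym)

record IsInducedEmbedding (A G : Graph) (ι : V A → V G) : Set where
  constructor isInducedEmbedding
  field
    preserves : IsHomomorphism A G ι
    reflects  : ∀ a b → Adj G (ι a) (ι b) → Adj A a b

id-isInducedEmbedding : (G : Graph) → IsInducedEmbedding G G id
id-isInducedEmbedding G = isInducedEmbedding (λ _ _ e → e) (λ _ _ e → e)

inj₁-∧-isInducedEmbedding : (G G' : Graph) → IsInducedEmbedding G (G ∧ G') inj₁
inj₁-∧-isInducedEmbedding G G' = isInducedEmbedding (λ _ _ e → e) (λ _ _ e → e)

inj₂-∧-isInducedEmbedding : (G G' : Graph) → IsInducedEmbedding G' (G ∧ G') inj₂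
inj₂-∧-isInducedEmbedding G G' = isInducedEmbedding (λ _ _ e → e) (λ _ _ e → e)

inj₁-∨-isInducedEmbedding : (G G' : Graph) → IsInducedEmbedding G (G ∨ G') inj₁
inj₁-∨-isInducedEmbedding G G' = isInducedEmbedding (λ _ _ e → e) (λ _ _ e → e)

inj₂-∨-isInducedEmbedding : (G G' : Graph) → IsInducedEmbedding G' (G ∨ G') inj₂
inj₂-∨-isInducedEmbedding G G' = isInducedEmbedding (λ _ _ e → e) (λ _ _ e → e)

⊎-map-∨-isInducedEmbedding : {A B C D : Graph} {ι : V A → V C} {ι' : V B → V D}
  → IsInducedEmbedding A C ι → IsInducedEmbedding B D ι'
  → IsInducedEmbedding (A ∨ B) (C ∨ D) (⊎-map ι ι')
⊎-map-∨-isInducedEmbedding {A} {B} {C} {D} {ι} {ι'} emb emb' = isInducedEmbedding preserves reflects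
  where
  preserves : IsHomomorphism (A ∨ B) (C ∨ D) (⊎-map ι ι')
  preserves (inj₁ a) (inj₁ b) = IsInducedEmbedding.preserves emb a b
  preserves (inj₂ a) (inj₂ b) = IsInducedEmbedding.preserves emb' a b

  reflects : ∀ a b → Adj (C ∨ D) (⊎-map ι ι' a) (⊎-map ι ι' b) → Adj (A ∨ B) a b
  reflects (inj₁ a) (inj₁ b) = IsInducedEmbedding.reflects emb a b
  reflects (inj₂ a) (inj₂ b) = IsInducedEmbedding.reflects emb' a b

SkewWitnessesInImage : (A B G G' : Graph)
  → (V A → V G) → (V B → V G') → (V A → V B) → (V G → V G') → Set
SkewWitnessesInImage A B G G' ι κ f h =
  ∀ a b u → Adj B (f a) b → Adj G (ι a) u → ¬ Adj G' (h u) (κ b) → Σ (V A) λ a' → ι a' ≡ u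

isSkewFibration-restrict : {A B G G' : Graph}
  {ι : V A → V G} {κ : V B → V G'} {f : V A → V B} {h : V G → V G'}
  → IsSkewFibration G G' h → IsInducedEmbedding A G ι → IsInducedEmbedding B G' κ
  → (∀ a → h (ι a) ≡ κ (f a)) → SkewWitnessesInImage A B G G' ι κ f h
  → IsSkewFibration A B f
isSkewFibration-restrict {A} {B} {G} {G'} {ι} {κ} {f} {h} (h-hom , h-skew) ι-emb κ-emb commutes inImage =
  f-hom , f-skew
  where
  module ι = IsInducedEmbedding ι-emb
  module κ = IsInducedEmbedding κ-emb

  adj-from-h∘ι : ∀ {a x} → Adj G' (κ (f a)) x → Adj G' (h (ι a)) x
  adj-from-h∘ι {a} {x} = subst (λ y → Adj G' y x) (≡-sym (commutes a))

  f-hom : IsHomomorphism A B f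
  f-hom a b e = κ.reflects (f a) (f b)
    (subst₂ (Adj G') (commutes a) (commutes b) (h-hom (ι a) (ι b) (ι.preserves a b e)))

  f-skew : ∀ a b → Adj B (f a) b → Σ (V A) λ a' → Adj A a a' × ¬ Adj B (f a') b
  f-skew a b e with h-skew (ι a) (κ b) (adj-from-h∘ι (κ.preserves (f a) b e))
  ... | u , adj-u , nadj-u with inImage a b u e adj-u nadj-u
  ... | a' , refl = a' , ι.reflects a a' adj-u , λ e' → nadj-u (adj-from-h∘ι (κ.preserves (f a') b e'))

module _ (G₁ G₂ H₁ H₂ K₁ K₂ L : Graph) (h : V ((G₁ ∧ G₂) ∨ (H₁ ∨ H₂)) → V ((K₁ ∧ K₂) ∨ L)) where

  first-witnesses-in-image :
    (pG₁ : (v : V G₁) → Σ (V K₁) λ k → h (inj₁ (inj₁ v)) ≡ inj₁ (inj₁ k))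
    (pG₂ : (v : V G₂) → Σ (V K₂) λ k → h (inj₁ (inj₂ v)) ≡ inj₁ (inj₂ k))
    (pH₁ : (v : V H₁) → Σ (V L) λ l → h (inj₂ (inj₁ v)) ≡ inj₂ l)
    → SkewWitnessesInImage (G₁ ∨ H₁) (K₁ ∨ L) ((G₁ ∧ G₂) ∨ (H₁ ∨ H₂)) ((K₁ ∧ K₂) ∨ L)
        (⊎-map inj₁ inj₁) (⊎-map inj₁ id)
        (⊎-map (λ v → proj₁ (pG₁ v)) (λ v → proj₁ (pH₁ v))) h
  first-witnesses-in-image _ _ _ (inj₁ _) (inj₁ _) (inj₁ (inj₁ u)) _ _ _ = inj₁ u , refl
  first-witnesses-in-image _ pG₂ _ (inj₁ _) (inj₁ _) (inj₁ (inj₂ u)) _ _ nadj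
    rewrite proj₂ (pG₂ u) = ⊥-elim (nadj tt)
  first-witnesses-in-image _ _ _ (inj₂ _) (inj₂ _) (inj₂ (inj₁ u)) _ _ _ = inj₂ u , refl

  second-witnesses-in-image :
    (pG₁ : (v : V G₁) → Σ (V K₁) λ k → h (inj₁ (inj₁ v)) ≡ inj₁ (inj₁ k))
    (pG₂ : (v : V G₂) → Σ (V K₂) λ k → h (inj₁ (inj₂ v)) ≡ inj₁ (inj₂ k))
    (pH₂ : (v : V H₂) → Σ (V L) λ l → h (inj₂ (inj₂ v)) ≡ inj₂ l)
    → SkewWitnessesInImage (G₂ ∨ H₂) (K₂ ∨ L) ((G₁ ∧ G₂) ∨ (H₁ ∨ H₂)) ((K₁ ∧ K₂) ∨ L)
        (⊎-map inj₂ inj₂) (⊎-map inj₂ id)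
        (⊎-map (λ v → proj₁ (pG₂ v)) (λ v → proj₁ (pH₂ v))) h
  second-witnesses-in-image _ _ _ (inj₁ _) (inj₁ _) (inj₁ (inj₂ u)) _ _ _ = inj₁ u , refl
  second-witnesses-in-image pG₁ _ _ (inj₁ _) (inj₁ _) (inj₁ (inj₁ u)) _ _ nadj
    rewrite proj₂ (pG₁ u) = ⊥-elim (nadj tt)
  second-witnesses-in-image _ _ _ (inj₂ _) (inj₂ _) (inj₂ (inj₂ u)) _ _ _ = inj₂ u , refl

lemma3 : (G₁ G₂ H₁ H₂ K₁ K₂ L : Graph)
    → (h : V ((G₁ ∧ G₂) ∨ (H₁ ∨ H₂)) → V ((K₁ ∧ K₂) ∨ L))
    → IsSkewFibration ((G₁ ∧ G₂) ∨ (H₁ ∨ H₂)) ((K₁ ∧ K₂) ∨ L) h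
    → (pG₁ : (v : V G₁) → Σ (V K₁) λ k → h (inj₁ (inj₁ v)) ≡ inj₁ (inj₁ k))
    → (pG₂ : (v : V G₂) → Σ (V K₂) λ k → h (inj₁ (inj₂ v)) ≡ inj₁ (inj₂ k))
    → (pH₁ : (v : V H₁) → Σ (V L) λ l → h (inj₂ (inj₁ v)) ≡ inj₂ l)
    → (pH₂ : (v : V H₂) → Σ (V L) λ l → h (inj₂ (inj₂ v)) ≡ inj₂ l)
    → IsSkewFibration (G₁ ∨ H₁) (K₁ ∨ L) (⊎-map (λ v → proj₁ (pG₁ v)) (λ v → proj₁ (pH₁ v)))
    × IsSkewFibration (G₂ ∨ H₂) (K₂ ∨ L) (⊎-map (λ v → proj₁ (pG₂ v)) (λ v → proj₁ (pH₂ v)))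
lemma3 G₁ G₂ H₁ H₂ K₁ K₂ L h sf pG₁ pG₂ pH₁ pH₂ =
    isSkewFibration-restrict {f = h₁} {h = h} sf
      (⊎-map-∨-isInducedEmbedding (inj₁-∧-isInducedEmbedding G₁ G₂) (inj₁-∨-isInducedEmbedding H₁ H₂))
      (⊎-map-∨-isInducedEmbedding (inj₁-∧-isInducedEmbedding K₁ K₂) (id-isInducedEmbedding L))
      h₁-commutes
      (first-witnesses-in-image G₁ G₂ H₁ H₂ K₁ K₂ L h pG₁ pG₂ pH₁)
  , isSkewFibration-restrict {f = h₂} {h = h} sf
      (⊎-map-∨-isInducedEmbedding (inj₂-∧-isInducedEmbedding G₁ G₂) (inj₂-∨-isInducedEmbedding H₁ H₂))
      (⊎-map-∨-isInducedEmbedding (inj₂-∧-isInducedEmbedding K₁ K₂) (id-isInducedEmbedding L))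
      h₂-commutes
      (second-witnesses-in-image G₁ G₂ H₁ H₂ K₁ K₂ L h pG₁ pG₂ pH₂)
  where
  h₁ : V (G₁ ∨ H₁) → V (K₁ ∨ L)
  h₁ = ⊎-map (λ v → proj₁ (pG₁ v)) (λ v → proj₁ (pH₁ v))

  h₁-commutes : ∀ a → h (⊎-map inj₁ inj₁ a) ≡ ⊎-map inj₁ id (h₁ a)
  h₁-commutes (inj₁ v) = proj₂ (pG₁ v)
  h₁-commutes (inj₂ v) = proj₂ (pH₁ v)

  h₂ : V (G₂ ∨ H₂) → V (K₂ ∨ L)
  h₂ = ⊎-map (λ v → proj₁ (pG₂ v)) (λ v → proj₁ (pH₂ v))

  h₂-commutes : ∀ a → h (⊎-map inj₂ inj₂ a) ≡ ⊎-map inj₂ id (h₂ a)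
  h₂-commutes (inj₁ v) = proj₂ (pG₂ v)
  h₂-commutes (inj₂ v) = proj₂ (pH₂ v)
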